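{- Let $G=(V,E,e)$ be a finite connected rooted graph with at least two vertices, let $k\geq2$, and for $N\geq2$ consider the free power $G^{*N}$ with graph distance $\partial$. Define $(\Delta^{[k]}_N)_{ij}=|\{l:\ l\sim j,\ \partial(i,l)=k\}|$ if $\partial(i,j)=k$ and $0$ otherwise, and $(D^{[k-1]}_N)_{ij}=|\{l:\ l\sim j,\ \partial(i,l)=k,\ j\text{ and }l\text{ in the same copy of }G\}|$ if $\partial(i,j)=k-1$ and $0$ otherwise. Then $\Delta^{[k]}_N/N^{(k+1)/2}$ and $D^{[k-1]}_N/N^{(k+1)/2}$ converge to zero as $N\to\infty$ in distribution with respect to the vacuum state, i.e. $\varphi_1\big((\Delta^{[k]}_N/N^{(k+1)/2})^m\big)\to0$ and $\varphi_1\big((D^{[k-1]}_N/N^{(k+1)/2})^m\big)\to0$ for every $m\geq1$.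
   Context: Free power: let $V^0=V\setminus\{e\}$. The vertices of $G^{*N}$ are the empty word (the root, denoted $e$) and all finite words $(v_1,i_1)\cdots(v_m,i_m)$ with $v_r\in V^0$, $i_r\in\{1,\dots,N\}$, $i_r\neq i_{r+1}$. For $i\in\{1,\dots,N\}$, a word $u$ whose first letter (if any) does not have index $i$, and $w\in V$, let $w\cdot_i u$ be $(w,i)u$ if $w\in V^0$ and $u$ if $w=e$; vertices $x,y$ are adjacent ($x\sim y$) iff $x=v\cdot_i u$, $y=v'\cdot_i u$ for some such $i,u$ and some edge $\{v,v'\}\in E$. Two vertices $x,y$ are in the same copy of $G$ if $x=(v,i)u$ and $y=(v',i)u$ for the same $i$ and $u$ and some $v,v'\in V^0$. The vacuum state is $\varphi_1(M)=M_{ee}$. -}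

module Defs where

open import Level using (0ℓ)
open import Data.Nat using (ℕ; zero; suc; _<_; _∸_)
open import Data.Fin using (Fin; _≟_)
open import Data.Product using (Σ; ∃; _×_; _,_)
open import Data.List using (List; []; _∷_; length)
open import Data.List.Relation.Unary.All using (All)
open import Data.List.Relation.Unary.Unique.Propositional using (Unique)
open import Data.List.Membership.Propositional using (_∈_)
open import Data.Vec using (Vec; []; _∷_)
open import Data.Unit using (⊤)
open import Relation.Nullary using (¬_; Dec; does)
open import Relation.Binary.PropositionalEquality using (_≡_; _≢_)
open import Data.Bool using (if_then_else_)

record RootedGraph (n : ℕ) : Set₁ where
  field
    E       : Fin n → Fin n → Set
    E-sym   : ∀ u v → E u v → E v u
    E-irr   : ∀ v → ¬ E v v
    E-dec   : ∀ u v → Dec (E u v)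
    root    : Fin n
open RootedGraph public

data GWalk {n : ℕ} (G : RootedGraph n) : Fin n → Fin n → ℕ → Set where
  gstop : ∀ {v} → GWalk G v v zero
  gstep : ∀ {u v w len} → E G u v → GWalk G v w len → GWalk G u w (suc len)

Connected : {n : ℕ} → RootedGraph n → Set
Connected G = ∀ u v → ∃ λ len → GWalk G u v len

-- The free power G^{*N}.  Letters (v , i) with v ∈ Fin n, index i ∈ Fin N
-- (Fin N stands for {1,…,N}).  Words are lists, first letter = head.

Word : ℕ → ℕ → Set
Word n N = List (Fin n × Fin N)

Alternating : {n N : ℕ} → Word n N → Set
Alternating []                          = ⊤
Alternating (_ ∷ [])                    = ⊤
Alternating ((_ , i) ∷ (w , j) ∷ rest)  = (i ≢ j) × Alternating ((w , j) ∷ rest)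

IsVertex : {n N : ℕ} → RootedGraph n → Word n N → Set
IsVertex G x = All (λ { (v , _) → v ≢ root G }) x × Alternating x

HeadNot : {n N : ℕ} → Fin N → Word n N → Set
HeadNot i []            = ⊤
HeadNot i ((_ , j) ∷ _) = j ≢ i

dot : {n N : ℕ} → RootedGraph n → Fin n → Fin N → Word n N → Word n N
dot G w i u = if does (w ≟ root G) then u else ((w , i) ∷ u)

_⊢_∼_ : {n N : ℕ} → RootedGraph n → Word n N → Word n N → Set
_⊢_∼_ {n} {N} G x y =
  Σ (Fin N) λ i → Σ (Word n N) λ u → Σ (Fin n) λ v → Σ (Fin n) λ v' →
    HeadNot i u × E G v v' × (x ≡ dot G v i u) × (y ≡ dot G v' i u)

data Walk {n N : ℕ} (G : RootedGraph n) : Word n N → Word n N → ℕ → Set where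
  stop : ∀ {x} → Walk G x x zero
  step : ∀ {x y z len} → G ⊢ x ∼ y → Walk G y z len → Walk G x z (suc len)

Dist : {n N : ℕ} → RootedGraph n → Word n N → Word n N → ℕ → Set
Dist G x y d = Walk G x y d × (∀ j → j < d → ¬ Walk G x y j)

SameCopy : {n N : ℕ} → RootedGraph n → Word n N → Word n N → Set
SameCopy {n} {N} G x y =
  Σ (Fin N) λ i → Σ (Word n N) λ u → Σ (Fin n) λ v → Σ (Fin n) λ v' →
    (v ≢ root G) × (v' ≢ root G) × (x ≡ (v , i) ∷ u) × (y ≡ (v' , i) ∷ u)

-- Vacuum moments, expanded as counts.
-- φ₁(Mᵐ) = (Mᵐ)_{ee} = Σ_{x₁,…,x_{m-1}} M_{e x₁} M_{x₁ x₂} ⋯ M_{x_{m-1} e}.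
-- For M = Δ^{[k]}, the entry M_{ij} is the number of l with
-- l ∼ j, ∂(i,l) = k (when ∂(i,j) = k, else 0); hence (Mᵐ)_{ee} is the number of
-- sequences ((x₁,l₁),…,(x_m,l_m)) with x_0 = e, x_m = e and, for each r,
-- ∂(x_{r-1},x_r) = k, l_r ∼ x_r, ∂(x_{r-1},l_r) = k.  Similarly for D^{[k-1]}.

-- chains starting at `prev` and ending at the root (empty word)
ChainΔ : {n N m : ℕ} → RootedGraph n → ℕ → Word n N → Vec (Word n N × Word n N) m → Set
ChainΔ G k prev []              = prev ≡ []
ChainΔ G k prev ((x , l) ∷ rest) =
  IsVertex G x × IsVertex G l ×
  Dist G prev x k × G ⊢ l ∼ x × Dist G prev l k × ChainΔ G k x rest

ChainD : {n N m : ℕ} → RootedGraph n → ℕ → Word n N → Vec (Word n N × Word n N) m → Set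
ChainD G k prev []              = prev ≡ []
ChainD G k prev ((x , l) ∷ rest) =
  IsVertex G x × IsVertex G l ×
  Dist G prev x (k ∸ 1) × G ⊢ l ∼ x × Dist G prev l k × SameCopy G x l ×
  ChainD G k x rest

HasCard : {A : Set} → (A → Set) → ℕ → Set
HasCard {A} P c = Σ (List A) λ L →
  Unique L × All P L × (∀ a → P a → a ∈ L) × (length L ≡ c)

VacuumMomentΔ : (n N : ℕ) → RootedGraph n → ℕ → ℕ → ℕ → Set
VacuumMomentΔ n N G k m c = HasCard (ChainΔ {n} {N} {m} G k []) c

VacuumMomentD : (n N : ℕ) → RootedGraph n → ℕ → ℕ → ℕ → Set
VacuumMomentD n N G k m c = HasCard (ChainD {n} {N} {m} G k []) c

{-# OPTIONS --safe #-}
-- A term of the vacuum moment is a closed chain of m links starting at the root: a geodesic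
-- of length k (resp. k - 1) to a vertex x, together with a neighbour l of x.  Every step of
-- G^{*N} pushes, pops or relabels the first letter of a word, and only a push chooses an
-- index in Fin N.  The neighbour l is reached from x without such a choice: by a pop or a
-- relabel, or, when l = (v , i) ∷ x is as far from the previous vertex as x is, the walk to l
-- cannot pass through x, so the previous vertex already lies in the branch (_ , i) ∷ x and
-- determines i.  Since the chain starts and ends at the root, pushes make up at most half
-- of its (at most m k) walk steps, so the moment is O(N^{⌊mk/2⌋}) = o(N^{m(k+1)/2}).
module Submission where

open import Defs
open import Data.Nat using (ℕ; zero; suc; z≤n; s≤s; _≤_; _<_; _*_; _^_; _+_; _∸_; ⌊_/2⌋; ⌈_/2⌉; NonZero)
open import Data.Nat.Properties
open import Data.Nat.Tactic.RingSolver using (solve-∀)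
open import Data.Fin as Fin using (Fin)
open import Data.List using (List; []; _∷_; [_]; _++_; length; map; drop; allFin; cartesianProductWith)
open import Data.List.Properties using (length-++; length-++-sucʳ; length-map; length-tabulate; map-++)
open import Data.Nat.ListAction using (sum)
open import Data.Nat.ListAction.Properties using (sum-++)
open import Data.List.Membership.Propositional using (_∈_)
open import Data.List.Membership.Propositional.Properties
  using (∈-map⁺; ∈-++⁺ˡ; ∈-++⁺ʳ; ∈-++⁻; ∈-∃++; ∈-allFin; ∈-cartesianProductWith⁺)
open import Data.List.Relation.Binary.Subset.Propositional using (_⊆_)
open import Data.List.Relation.Unary.Any using (here; there)
open import Data.List.Relation.Unary.All as All using (All; []; _∷_)
open import Data.List.Relation.Unary.AllPairs using ([]; _∷_)
open import Data.List.Relation.Unary.Unique.Propositional using (Unique)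
open import Data.Vec using (Vec; []; _∷_)
open import Data.Product using (∃; ∃₂; _×_; _,_; proj₁)
open import Data.Sum using (_⊎_; inj₁; inj₂)
open import Data.Empty using (⊥-elim)
open import Relation.Nullary using (yes; no)
open import Relation.Binary.PropositionalEquality using (_≡_; refl; sym; trans; cong; cong₂; subst; module ≡-Reasoning)

module _ {A : Set} where

  Unique-⊆⇒length-≤ : {xs ys : List A} → Unique xs → xs ⊆ ys → length xs ≤ length ys
  Unique-⊆⇒length-≤ [] _ = z≤n
  Unique-⊆⇒length-≤ {x ∷ xs} (x∉xs ∷ uniq) xs⊆ys with ∈-∃++ (xs⊆ys (here refl))
  ... | pre , post , refl = begin
      suc (length xs)            ≤⟨ s≤s (Unique-⊆⇒length-≤ uniq xs⊆pre++post) ⟩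
      suc (length (pre ++ post)) ≡⟨ length-++-sucʳ pre x post ⟨
      length (pre ++ x ∷ post)   ∎
    where
    open ≤-Reasoning
    xs⊆pre++post : xs ⊆ pre ++ post
    xs⊆pre++post {a} a∈xs with ∈-++⁻ pre (xs⊆ys (there a∈xs))
    ... | inj₁ a∈pre          = ∈-++⁺ˡ a∈pre
    ... | inj₂ (here a≡x)     = ⊥-elim (All.lookup x∉xs a∈xs (sym a≡x))
    ... | inj₂ (there a∈post) = ∈-++⁺ʳ pre a∈post

  drop-length-++ : (ys zs : List A) → drop (length ys) (ys ++ zs) ≡ zs
  drop-length-++ []       zs = refl
  drop-length-++ (_ ∷ ys) zs = drop-length-++ ys zs

  suffix : ℕ → List A → List A
  suffix k xs = drop (length xs ∸ k) xs

  suffix-++ : (ys zs : List A) → suffix (length zs) (ys ++ zs) ≡ zs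
  suffix-++ ys zs rewrite length-++ ys {zs} | m+n∸n≡m (length ys) (length zs) = drop-length-++ ys zs

length-cartesianProductWith : {A B C : Set} (f : A → B → C) (xs : List A) (ys : List B) →
                              length (cartesianProductWith f xs ys) ≡ length xs * length ys
length-cartesianProductWith f []       ys = refl
length-cartesianProductWith f (x ∷ xs) ys = begin
    length (map (f x) ys ++ cartesianProductWith f xs ys)
      ≡⟨ length-++ (map (f x) ys) ⟩
    length (map (f x) ys) + length (cartesianProductWith f xs ys)
      ≡⟨ cong₂ _+_ (length-map (f x) ys) (length-cartesianProductWith f xs ys) ⟩
    length ys + length xs * length ys ∎
  where open ≡-Reasoning

length-allFin : ∀ k → length (allFin k) ≡ k
length-allFin k = length-tabulate {n = k} (λ i → i)

2*⌊n/2⌋≤n : ∀ n → 2 * ⌊ n /2⌋ ≤ n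
2*⌊n/2⌋≤n n = begin
  2 * ⌊ n /2⌋         ≡⟨ cong (⌊ n /2⌋ +_) (+-identityʳ ⌊ n /2⌋) ⟩
  ⌊ n /2⌋ + ⌊ n /2⌋   ≤⟨ +-monoʳ-≤ ⌊ n /2⌋ (⌊n/2⌋≤⌈n/2⌉ n) ⟩
  ⌊ n /2⌋ + ⌈ n /2⌉   ≡⟨ ⌊n/2⌋+⌈n/2⌉≡n n ⟩
  n                   ∎
  where open ≤-Reasoning

2*m≤n⇒m≤⌊n/2⌋ : ∀ {m n} → 2 * m ≤ n → m ≤ ⌊ n /2⌋
2*m≤n⇒m≤⌊n/2⌋ {m} {n} 2m≤n = begin
  m                ≡⟨ n≡⌊n+n/2⌋ m ⟩
  ⌊ m + m /2⌋      ≤⟨ ⌊n/2⌋-mono (subst (_≤ n) (cong (m +_) (+-identityʳ m)) 2m≤n) ⟩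
  ⌊ n /2⌋          ∎
  where open ≤-Reasoning

module Words {S : Set} (weight : S → ℕ) (cheap costly : List S) where

  prepend : List S → List (List S) → List (List S)
  prepend = cartesianProductWith _∷_

  words : ℕ → ℕ → List (List S)
  words zero    _       = [ [] ]
  words (suc L) zero    = prepend cheap (words L zero)
  words (suc L) (suc E) = prepend cheap (words L (suc E)) ++ prepend costly (words L E)

  ∈-words-cheap : ∀ {s cs} L E → s ∈ cheap → cs ∈ words L E → s ∷ cs ∈ words (suc L) E
  ∈-words-cheap L zero    s∈ cs∈ = ∈-cartesianProductWith⁺ _∷_ s∈ cs∈
  ∈-words-cheap L (suc E) s∈ cs∈ = ∈-++⁺ˡ (∈-cartesianProductWith⁺ _∷_ s∈ cs∈)

  ∈-words : (∀ s → (weight s ≡ 0 × s ∈ cheap) ⊎ (1 ≤ weight s × s ∈ costly)) →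
            ∀ {L E} cs → length cs ≡ L → sum (map weight cs) ≤ E → cs ∈ words L E
  ∈-words classify []       refl _ = here refl
  ∈-words classify {E = E} (s ∷ cs) refl weight≤E with classify s
  ... | inj₁ (s≡0 , s∈) =
    ∈-words-cheap _ E s∈
      (∈-words classify cs refl (subst (λ w → w + sum (map weight cs) ≤ E) s≡0 weight≤E))
  ... | inj₂ (1≤s , s∈) = costly-case E (≤-trans (+-monoˡ-≤ _ 1≤s) weight≤E)
    where
    costly-case : ∀ E → suc (sum (map weight cs)) ≤ E → s ∷ cs ∈ words (suc (length cs)) E
    costly-case (suc E) (s≤s rest≤E) =
      ∈-++⁺ʳ _ (∈-cartesianProductWith⁺ _∷_ s∈ (∈-words classify cs refl rest≤E))

  length-prepend : ∀ xs Ws → length (prepend xs Ws) ≡ length xs * length Ws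
  length-prepend = length-cartesianProductWith _∷_

  length-words : ∀ {a b N} .{{_ : NonZero N}} → length cheap ≤ a → length costly ≤ b * N →
                 ∀ L E → length (words L E) ≤ (a + b) ^ L * N ^ E
  length-words {N = N} _ _ zero E = ≤-trans (m^n>0 N E) (≤-reflexive (sym (*-identityˡ (N ^ E))))
  length-words {a} {b} cheap≤ costly≤ (suc L) zero = begin
      length (prepend cheap (words L 0))
        ≡⟨ length-prepend cheap (words L 0) ⟩
      length cheap * length (words L 0)
        ≤⟨ *-mono-≤ (≤-trans cheap≤ (m≤m+n a b)) (length-words cheap≤ costly≤ L 0) ⟩
      (a + b) * ((a + b) ^ L * 1)
        ≡⟨ *-assoc (a + b) ((a + b) ^ L) 1 ⟨
      (a + b) ^ suc L * 1 ∎
    where open ≤-Reasoning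
  length-words {a} {b} {N} cheap≤ costly≤ (suc L) (suc E) = begin
      length (prepend cheap W₁ ++ prepend costly W₀)
        ≡⟨ length-++ (prepend cheap W₁) ⟩
      length (prepend cheap W₁) + length (prepend costly W₀)
        ≡⟨ cong₂ _+_ (length-prepend cheap W₁) (length-prepend costly W₀) ⟩
      length cheap * length W₁ + length costly * length W₀
        ≤⟨ +-mono-≤ (*-mono-≤ cheap≤ (length-words cheap≤ costly≤ L (suc E)))
                    (*-mono-≤ costly≤ (length-words cheap≤ costly≤ L E)) ⟩
      a * ((a + b) ^ L * N ^ suc E) + b * N * ((a + b) ^ L * N ^ E)
        ≡⟨ regroup a b N ((a + b) ^ L) (N ^ E) ⟩
      (a + b) ^ suc L * N ^ suc E ∎
    where
    open ≤-Reasoning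
    W₁ = words L (suc E)
    W₀ = words L E
    regroup : ∀ a b N X Y → a * (X * (N * Y)) + b * N * (X * Y) ≡ (a + b) * X * (N * Y)
    regroup = solve-∀

data Move (n N : ℕ) : Set where
  pop     : Move n N
  relabel : Fin n → Move n N
  push    : Fin n → Fin N → Move n N
  extend  : Fin n → Move n N

module _ {n N : ℕ} where

  weight : Move n N → ℕ
  weight (push _ _) = 1
  weight _          = 0

  pushes : List (Move n N) → ℕ
  pushes ms = sum (map weight ms)

  -- extend needs the previous vertex of the chain and is interpreted by neighbour;
  -- walks never use it.
  apply : Move n N → Word n N → Word n N
  apply pop         []            = []
  apply pop         (_ ∷ u)       = u
  apply (relabel v) []            = []
  apply (relabel v) ((_ , i) ∷ u) = (v , i) ∷ u
  apply (push v i)  x             = (v , i) ∷ x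
  apply (extend _)  x             = x

  run : ℕ → Word n N → List (Move n N) → Word n N × List (Move n N)
  run zero      x ms       = x , ms
  run (suc len) x []       = x , []
  run (suc len) x (s ∷ ms) = run len (apply s x) ms

  -- (v , i) ∷ x, where i is the index of the letter of prev lying directly above x
  extendAsIn : Word n N → Word n N → Fin n → Word n N
  extendAsIn prev x v with suffix (suc (length x)) prev
  ... | []          = x
  ... | (_ , i) ∷ _ = (v , i) ∷ x

  neighbour : Word n N → Word n N → Move n N → Word n N
  neighbour prev x (extend v) = extendAsIn prev x v
  neighbour prev x s          = apply s x

  cheapMoves : List (Move n N)
  cheapMoves = pop ∷ map relabel (allFin n) ++ map extend (allFin n)

  pushMoves : List (Move n N)
  pushMoves = cartesianProductWith push (allFin n) (allFin N)

  classifyMove : ∀ s → (weight s ≡ 0 × s ∈ cheapMoves) ⊎ (1 ≤ weight s × s ∈ pushMoves)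
  classifyMove pop         = inj₁ (refl , here refl)
  classifyMove (relabel v) = inj₁ (refl , there (∈-++⁺ˡ (∈-map⁺ relabel (∈-allFin v))))
  classifyMove (extend v)  =
    inj₁ (refl , there (∈-++⁺ʳ (map relabel (allFin n)) (∈-map⁺ extend (∈-allFin v))))
  classifyMove (push v i)  = inj₂ (≤-refl , ∈-cartesianProductWith⁺ push (∈-allFin v) (∈-allFin i))

  length-cheapMoves : length cheapMoves ≡ 1 + 2 * n
  length-cheapMoves = cong suc (begin
    length (map relabel (allFin n) ++ map extend (allFin n))
      ≡⟨ length-++ (map relabel (allFin n)) ⟩
    length (map relabel (allFin n)) + length (map extend (allFin n))
      ≡⟨ cong₂ _+_ (trans (length-map relabel (allFin n)) (length-allFin n))
                   (trans (length-map extend (allFin n)) (trans (length-allFin n) (sym (+-identityʳ n)))) ⟩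
    2 * n ∎)
    where open ≡-Reasoning

  length-pushMoves : length pushMoves ≡ n * N
  length-pushMoves = trans (length-cartesianProductWith push (allFin n) (allFin N))
                           (cong₂ _*_ (length-allFin n) (length-allFin N))

module FreePower {n N : ℕ} (G : RootedGraph n) where

  data Adjacency : Word n N → Word n N → Set where
    pushed     : ∀ v i x    → Adjacency x ((v , i) ∷ x)
    popped     : ∀ v i y    → Adjacency ((v , i) ∷ y) y
    relabelled : ∀ v v' i u → Adjacency ((v , i) ∷ u) ((v' , i) ∷ u)

  adjacency : ∀ {x y} → G ⊢ x ∼ y → Adjacency x y
  adjacency (i , u , v , v' , _ , v~v' , refl , refl) with v Fin.≟ root G | v' Fin.≟ root G
  ... | yes v≡e | yes v'≡e = ⊥-elim (E-irr G v (subst (E G v) (trans v'≡e (sym v≡e)) v~v'))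
  ... | yes _   | no _     = pushed v' i u
  ... | no _    | yes _    = popped v i u
  ... | no _    | no _     = relabelled v v' i u

  moveOf : ∀ {x y} → Adjacency x y → Move n N
  moveOf (pushed v i _)        = push v i
  moveOf (popped _ _ _)        = pop
  moveOf (relabelled _ v' _ _) = relabel v'

  apply-moveOf : ∀ {x y} (adj : Adjacency x y) → apply (moveOf adj) x ≡ y
  apply-moveOf (pushed _ _ _)       = refl
  apply-moveOf (popped _ _ _)       = refl
  apply-moveOf (relabelled _ _ _ _) = refl

  weight-moveOf : ∀ {x y} (adj : Adjacency x y) →
                  2 * weight (moveOf adj) + length x ≤ 1 + length y
  weight-moveOf (pushed _ _ _)       = ≤-refl
  weight-moveOf (popped _ _ _)       = ≤-refl
  weight-moveOf (relabelled _ _ _ _) = n≤1+n _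

  walkMoves : ∀ {x y len} → Walk G x y len → List (Move n N)
  walkMoves stop          = []
  walkMoves (step adj wk) = moveOf (adjacency adj) ∷ walkMoves wk

  length-walkMoves : ∀ {x y len} (wk : Walk G x y len) → length (walkMoves wk) ≡ len
  length-walkMoves stop        = refl
  length-walkMoves (step _ wk) = cong suc (length-walkMoves wk)

  run-walkMoves : ∀ {x y len} (wk : Walk G x y len) ms → run len x (walkMoves wk ++ ms) ≡ (y , ms)
  run-walkMoves stop          ms = refl
  run-walkMoves (step adj wk) ms
    rewrite apply-moveOf (adjacency adj) = run-walkMoves wk ms

  -- With P pushes and Q pops: P + Q ≤ len and length y = length x + P - Q.
  pushes-walkMoves : ∀ {x y len} (wk : Walk G x y len) →
                     2 * pushes (walkMoves wk) + length x ≤ len + length y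
  pushes-walkMoves stop = ≤-refl
  pushes-walkMoves {x} {y} (step {y = z} {len = len} adj wk) = begin
      2 * (w + P) + length x       ≡⟨ regroup w P (length x) ⟩
      (2 * w + length x) + 2 * P   ≤⟨ +-monoˡ-≤ (2 * P) (weight-moveOf (adjacency adj)) ⟩
      (1 + length z) + 2 * P       ≡⟨ cong suc (+-comm (length z) (2 * P)) ⟩
      1 + (2 * P + length z)       ≤⟨ +-monoʳ-≤ 1 (pushes-walkMoves wk) ⟩
      1 + (len + length y)         ∎
    where
    open ≤-Reasoning
    w = weight (moveOf (adjacency adj))
    P = pushes (walkMoves wk)
    regroup : ∀ w P x → 2 * (w + P) + x ≡ (2 * w + x) + 2 * P
    regroup = solve-∀

  InBranch : Fin N → Word n N → Word n N → Set
  InBranch i x a = ∃₂ λ y w → a ≡ y ++ (w , i) ∷ x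

  adjacent-into-branch : ∀ {a b i x} → Adjacency a b → InBranch i x b → InBranch i x a ⊎ a ≡ x
  adjacent-into-branch (pushed _ _ _)       ([]    , _ , refl) = inj₂ refl
  adjacent-into-branch (pushed _ _ _)       (_ ∷ y , w , refl) = inj₁ (y , w , refl)
  adjacent-into-branch (popped v i _)       (y     , w , refl) = inj₁ ((v , i) ∷ y , w , refl)
  adjacent-into-branch (relabelled v _ _ _) ([]    , _ , refl) = inj₁ ([] , v , refl)
  adjacent-into-branch (relabelled v _ i _) (_ ∷ y , w , refl) = inj₁ ((v , i) ∷ y , w , refl)

  -- Words form a tree in which (v , i) ∷ x hangs below x, so a walk entering that branch
  -- from outside has to pass through x first.
  walk-into-branch : ∀ {a v i x len} → Walk G a ((v , i) ∷ x) len →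
                     InBranch i x a ⊎ ∃ λ len' → len' < len × Walk G a x len'
  walk-into-branch {v = v} stop = inj₁ ([] , v , refl)
  walk-into-branch (step adj wk) with walk-into-branch wk
  ... | inj₂ (len' , len'<len , wk') = inj₂ (suc len' , s≤s len'<len , step adj wk')
  ... | inj₁ b∈ with adjacent-into-branch (adjacency adj) b∈
  ...   | inj₁ a∈  = inj₁ a∈
  ...   | inj₂ refl = inj₂ (0 , s≤s z≤n , stop)

  extendAsIn-InBranch : ∀ {prev i x} v → InBranch i x prev → extendAsIn prev x v ≡ (v , i) ∷ x
  extendAsIn-InBranch {i = i} {x} v (y , w , refl)
    with suffix (suc (length x)) (y ++ (w , i) ∷ x) | suffix-++ y ((w , i) ∷ x)
  ... | _ | refl = refl

  CheapNeighbour : Word n N → Word n N → Word n N → Set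
  CheapNeighbour prev x l = ∃ λ s → weight s ≡ 0 × neighbour prev x s ≡ l

  cheapNeighbour-notFarther : ∀ {prev x l d} → Dist G prev x d → G ⊢ l ∼ x → Walk G prev l d →
                          CheapNeighbour prev x l
  cheapNeighbour-notFarther (_ , x-minimal) l~x prev⇝l with adjacency l~x
  ... | pushed _ _ _       = pop , refl , refl
  ... | relabelled v _ _ _ = relabel v , refl , refl
  ... | popped v _ _ with walk-into-branch prev⇝l
  ...   | inj₁ prev∈branch           = extend v , refl , extendAsIn-InBranch v prev∈branch
  ...   | inj₂ (len , len<d , prev⇝x) = ⊥-elim (x-minimal len len<d prev⇝x)

  cheapNeighbour-sameCopy : ∀ {prev x l} → SameCopy G x l → CheapNeighbour prev x l
  cheapNeighbour-sameCopy (_ , _ , _ , v' , _ , _ , refl , refl) = relabel v' , refl , refl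

  Link : Set
  Link = Word n N × Word n N

  WalkChain : ∀ {m} → ℕ → Word n N → Vec Link m → Set
  WalkChain d prev []              = prev ≡ []
  WalkChain d prev ((x , l) ∷ rest) = Walk G prev x d × CheapNeighbour prev x l × WalkChain d x rest

  ChainΔ⇒WalkChain : ∀ {m k prev} {a : Vec Link m} → ChainΔ G k prev a → WalkChain k prev a
  ChainΔ⇒WalkChain {a = []}    end = end
  ChainΔ⇒WalkChain {a = _ ∷ _} (_ , _ , prev-x , l~x , prev-l , rest) =
    proj₁ prev-x , cheapNeighbour-notFarther prev-x l~x (proj₁ prev-l) , ChainΔ⇒WalkChain rest

  ChainD⇒WalkChain : ∀ {m k prev} {a : Vec Link m} → ChainD G k prev a → WalkChain (k ∸ 1) prev a
  ChainD⇒WalkChain {a = []}    end = end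
  ChainD⇒WalkChain {a = _ ∷ _} (_ , _ , prev-x , _ , _ , x≈l , rest) =
    proj₁ prev-x , cheapNeighbour-sameCopy x≈l , ChainD⇒WalkChain rest

  encodeChain : ∀ {m d prev} {a : Vec Link m} → WalkChain d prev a → List (Move n N)
  encodeChain {a = []}    _                     = []
  encodeChain {a = _ ∷ _} (wk , (s , _) , rest) = walkMoves wk ++ s ∷ encodeChain rest

  -- The junk link (x , x) is only produced when the moves run out.
  decodeChain : (d m : ℕ) → Word n N → List (Move n N) → Vec Link m
  decodeChain d zero    prev ms = []
  decodeChain d (suc m) prev ms with run d prev ms
  ... | x , []      = (x , x) ∷ decodeChain d m x []
  ... | x , s ∷ ms' = (x , neighbour prev x s) ∷ decodeChain d m x ms'

  decode-encodeChain : ∀ {m d prev} {a : Vec Link m} (c : WalkChain d prev a) →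
                       decodeChain d m prev (encodeChain c) ≡ a
  decode-encodeChain {a = []}    refl = refl
  decode-encodeChain {a = _ ∷ _} (wk , (s , _ , s↦l) , rest)
    rewrite run-walkMoves wk (s ∷ encodeChain rest) | s↦l | decode-encodeChain rest = refl

  length-encodeChain : ∀ {m d prev} {a : Vec Link m} (c : WalkChain d prev a) →
                       length (encodeChain c) ≡ m * suc d
  length-encodeChain {a = []} _ = refl
  length-encodeChain {suc m} {d} {a = _ ∷ _} (wk , (s , _) , rest) = begin
    length (walkMoves wk ++ s ∷ encodeChain rest)
      ≡⟨ length-++ (walkMoves wk) ⟩
    length (walkMoves wk) + suc (length (encodeChain rest))
      ≡⟨ cong₂ (λ p q → p + suc q) (length-walkMoves wk) (length-encodeChain rest) ⟩
    d + suc (m * suc d)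
      ≡⟨ +-suc d (m * suc d) ⟩
    suc d + m * suc d ∎
    where open ≡-Reasoning

  pushes-encodeChain : ∀ {m d prev} {a : Vec Link m} (c : WalkChain d prev a) →
                       2 * pushes (encodeChain c) + length prev ≤ m * d
  pushes-encodeChain {a = []}    refl = ≤-refl
  pushes-encodeChain {suc m} {d} {prev} {a = (x , _) ∷ _} (wk , (s , s≡0 , _) , rest) = begin
      2 * pushes (walkMoves wk ++ s ∷ encodeChain rest) + length prev
        ≡⟨ cong (λ p → 2 * p + length prev) pushes-split ⟩
      2 * (P + R) + length prev      ≡⟨ regroup P R (length prev) ⟩
      (2 * P + length prev) + 2 * R  ≤⟨ +-monoˡ-≤ (2 * R) (pushes-walkMoves wk) ⟩
      (d + length x) + 2 * R         ≡⟨ regroup′ d (length x) (2 * R) ⟩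
      d + (2 * R + length x)         ≤⟨ +-monoʳ-≤ d (pushes-encodeChain rest) ⟩
      d + m * d                      ∎
    where
    open ≤-Reasoning
    P = pushes (walkMoves wk)
    R = pushes (encodeChain rest)
    pushes-split : pushes (walkMoves wk ++ s ∷ encodeChain rest) ≡ P + R
    pushes-split = begin-equality
      sum (map weight (walkMoves wk ++ s ∷ encodeChain rest))
        ≡⟨ cong sum (map-++ weight (walkMoves wk) (s ∷ encodeChain rest)) ⟩
      sum (map weight (walkMoves wk) ++ map weight (s ∷ encodeChain rest))
        ≡⟨ sum-++ (map weight (walkMoves wk)) (map weight (s ∷ encodeChain rest)) ⟩
      P + (weight s + R)
        ≡⟨ cong (λ w → P + (w + R)) s≡0 ⟩
      P + R ∎
    regroup : ∀ P R p → 2 * (P + R) + p ≡ (2 * P + p) + 2 * R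
    regroup = solve-∀
    regroup′ : ∀ d x r → (d + x) + r ≡ d + (r + x)
    regroup′ = solve-∀

  chains-bound : ∀ {m d} .{{_ : NonZero N}} {Ls : List (Vec Link m)} →
                 Unique Ls → All (WalkChain d []) Ls →
                 length Ls ≤ (1 + 2 * n + n) ^ (m * suc d) * N ^ ⌊ m * d /2⌋
  chains-bound {m} {d} {Ls = Ls} unique chains = begin
      length Ls
        ≤⟨ Unique-⊆⇒length-≤ unique Ls⊆decoded ⟩
      length (map (decodeChain d m []) codes)
        ≡⟨ length-map (decodeChain d m []) codes ⟩
      length codes
        ≤⟨ length-words (≤-reflexive (length-cheapMoves {n} {N}))
                        (≤-reflexive (length-pushMoves {n} {N})) L P ⟩
      (1 + 2 * n + n) ^ L * N ^ P ∎
    where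
    open ≤-Reasoning
    open Words (weight {n} {N}) cheapMoves pushMoves
    L = m * suc d
    P = ⌊ m * d /2⌋
    codes = words L P
    code∈codes : ∀ {a} (c : WalkChain d [] a) → encodeChain c ∈ codes
    code∈codes c = ∈-words classifyMove (encodeChain c) (length-encodeChain c)
      (2*m≤n⇒m≤⌊n/2⌋ (≤-trans (m≤m+n _ 0) (pushes-encodeChain c)))
    Ls⊆decoded : Ls ⊆ map (decodeChain d m []) codes
    Ls⊆decoded a∈Ls = let c = All.lookup chains a∈Ls in
      subst (_∈ map (decodeChain d m []) codes) (decode-encodeChain c)
            (∈-map⁺ (decodeChain d m []) (code∈codes c))

  momentΔ-bound : ∀ {k m c} .{{_ : NonZero N}} → VacuumMomentΔ n N G k m c →
                  c ≤ (1 + 2 * n + n) ^ (m * suc k) * N ^ ⌊ m * k /2⌋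
  momentΔ-bound (_ , unique , chains , _ , refl) =
    chains-bound unique (All.map ChainΔ⇒WalkChain chains)

  momentD-bound : ∀ {k m c} .{{_ : NonZero N}} → VacuumMomentD n N G k m c →
                  c ≤ (1 + 2 * n + n) ^ (m * suc (k ∸ 1)) * N ^ ⌊ m * (k ∸ 1) /2⌋
  momentD-bound (_ , unique , chains , _ , refl) =
    chains-bound unique (All.map ChainD⇒WalkChain chains)

suc-m*k≤m*[k+1] : ∀ {m} k → 1 ≤ m → suc (m * k) ≤ m * (k + 1)
suc-m*k≤m*[k+1] {m} k 1≤m = begin
  suc (m * k)   ≡⟨ +-comm 1 (m * k) ⟩
  m * k + 1     ≤⟨ +-monoʳ-≤ (m * k) 1≤m ⟩
  m * k + m     ≡⟨ distrib m k ⟩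
  m * (k + 1)   ∎
  where
  open ≤-Reasoning
  distrib : ∀ m k → m * k + m ≡ m * (k + 1)
  distrib = solve-∀

-- c ≤ K N^P with 2P ≤ mk gives (q c)² ≤ (q K)² N^{mk}, and m(k+1) ≥ mk + 1.
moments-vanish : ∀ {m k} (Moment : ℕ → ℕ → Set) (K P : ℕ) → 1 ≤ m → 2 * P ≤ m * k →
                 (∀ {N c} .{{_ : NonZero N}} → Moment N c → c ≤ K * N ^ P) →
                 (q : ℕ) → ∃ λ N₀ → (N : ℕ) → N₀ ≤ N → 2 ≤ N → (c : ℕ) → Moment N c →
                 (q * c) ^ 2 < N ^ (m * (k + 1))
moments-vanish {m} {k} Moment K P 1≤m 2P≤mk bound q = suc ((q * K) ^ 2) , small
  where
  small : (N : ℕ) → suc ((q * K) ^ 2) ≤ N → 2 ≤ N → (c : ℕ) → Moment N c →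
          (q * c) ^ 2 < N ^ (m * (k + 1))
  small N@(suc _) qK²<N _ c moment = begin-strict
    (q * c) ^ 2                ≤⟨ ^-monoˡ-≤ 2 (*-monoʳ-≤ q (bound moment)) ⟩
    (q * (K * N ^ P)) ^ 2      ≡⟨ square-* q K (N ^ P) ⟩
    (q * K) ^ 2 * (N ^ P) ^ 2  ≡⟨ cong ((q * K) ^ 2 *_) (trans (^-*-assoc N P 2) (cong (N ^_) (*-comm P 2))) ⟩
    (q * K) ^ 2 * N ^ (2 * P)  ≤⟨ *-monoʳ-≤ ((q * K) ^ 2) (^-monoʳ-≤ N 2P≤mk) ⟩
    (q * K) ^ 2 * N ^ (m * k)  <⟨ *-monoˡ-< (N ^ (m * k)) {{m^n≢0 N (m * k)}} qK²<N ⟩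
    N ^ suc (m * k)            ≤⟨ ^-monoʳ-≤ N (suc-m*k≤m*[k+1] k 1≤m) ⟩
    N ^ (m * (k + 1))          ∎
    where
    open ≤-Reasoning
    square-* : ∀ q K X → (q * (K * X)) ^ 2 ≡ (q * K) ^ 2 * X ^ 2
    square-* = unfolded
      where
      unfolded : ∀ q K X → q * (K * X) * (q * (K * X) * 1) ≡ q * K * (q * K * 1) * (X * (X * 1))
      unfolded = solve-∀

corollary5p4 : (n : ℕ) (G : RootedGraph n) → 2 ≤ n → Connected G →
    (k : ℕ) → 2 ≤ k → (m : ℕ) → 1 ≤ m →
    ((q : ℕ) → 1 ≤ q → ∃ λ N₀ → (N : ℕ) → N₀ ≤ N → 2 ≤ N → (c : ℕ) →
        VacuumMomentΔ n N G k m c → (q * c) ^ 2 < N ^ (m * (k + 1)))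
    ×
    ((q : ℕ) → 1 ≤ q → ∃ λ N₀ → (N : ℕ) → N₀ ≤ N → 2 ≤ N → (c : ℕ) →
        VacuumMomentD n N G k m c → (q * c) ^ 2 < N ^ (m * (k + 1)))
corollary5p4 n G _ _ k _ m 1≤m =
    (λ q _ → moments-vanish (λ N → VacuumMomentΔ n N G k m)
               ((1 + 2 * n + n) ^ (m * suc k)) ⌊ m * k /2⌋ 1≤m
               (2*⌊n/2⌋≤n (m * k))
               (FreePower.momentΔ-bound G) q)
  , (λ q _ → moments-vanish (λ N → VacuumMomentD n N G k m)
               ((1 + 2 * n + n) ^ (m * suc (k ∸ 1))) ⌊ m * (k ∸ 1) /2⌋ 1≤m
               (≤-trans (2*⌊n/2⌋≤n (m * (k ∸ 1))) (*-monoʳ-≤ m (m∸n≤m k 1)))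
               (FreePower.momentD-bound G) q)
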